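{- Let $n,k\in\mathbb{Z}^+$ with $k$ even and $p=nk+1$ prime, let $g$ be a primitive root modulo $p$, and for $i\in\mathbb{Z}$ let $X_i=\{g^{an+i} : a=0,1,\ldots,k-1\}\subseteq\mathbb{F}_p$ (so $X_i$ depends only on $i \bmod n$). Call a triple of indices $(s,t,u)$ forbidden (with respect to $g$) if $(X_s+X_t)\cap X_u=\emptyset$. Let $j$ be an integer with $\gcd(j,n)=1$, and suppose that the forbidden triples with respect to $g$ are exactly those whose underlying multiset of residues modulo $n$ is of the form $\{i,i,i+j\}$ for some $i$. Then $X_j$ contains a primitive root $h$ modulo $p$, and if one defines $Y_i=\{h^{an+i} : a=0,\ldots,k-1\}$, then the triples $(s,t,u)$ with $(Y_s+Y_t)\cap Y_u=\emptyset$ are exactly those whose underlying multiset of residues modulo $n$ is of the form $\{i,i,i+1\}$ for some $i$.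
   Context: This is the Comer algebra $C(p,n)$: its diversity atoms are the relations $A_i=\{(x,y)\in\mathbb{F}_p^2 : x-y\in X_i\}$, and the cycle $A_sA_tA_u$ is forbidden iff $(X_s+X_t)\cap X_u=\emptyset$. Since $k$ is even, $-1 \in X_0$, so each $X_i$ is symmetric ($-X_i=X_i$) and forbiddenness of a triple depends only on the multiset of indices. Sums of sets are Minkowski sums. -}

module Defs where

open import Data.Nat using (ℕ; zero; suc; _+_; _*_; _∸_; _^_; _≤_; _<_; _%_; NonZero)
open import Data.Nat.Divisibility using (_∣_)
open import Data.Integer as ℤ using (ℤ; +_)
open import Data.Integer.DivMod using (_%ℕ_)
open import Data.Product using (Σ; ∃; _×_; _,_)
open import Data.List using (List; _∷_; [])
open import Data.List.Relation.Binary.Permutation.Propositional using (_↭_)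
open import Relation.Nullary using (¬_)
open import Relation.Binary.PropositionalEquality using (_≡_; _≢_)

-- Integer residue e mod m as a natural number in [0, m); junk value 0 for m = 0
-- (never used: all moduli below are positive under the hypotheses).
_modZ_ : ℤ → ℕ → ℕ
e modZ zero    = 0
e modZ (suc m) = e %ℕ suc m

-- Throughout, p = n * k + 1, and elements of 𝔽_p are natural numbers read modulo p.

-- g ^ e in 𝔽_p^* for an integer exponent e: since the multiplicative group has
-- order p - 1 = n * k, g^e = g^(e mod (n k)).
powZ : (n k : ℕ) → ℕ → ℤ → ℕ
powZ n k g e = (g ^ (e modZ (n * k))) % suc (n * k)

InX : (n k g : ℕ) → ℤ → ℕ → Set
InX n k g i x = Σ ℕ λ a → a < k × (x % suc (n * k) ≡ powZ n k g (+ (a * n) ℤ.+ i))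

Forbidden : (n k g : ℕ) → ℤ → ℤ → ℤ → Set
Forbidden n k g s t u =
  ¬ (Σ ℕ λ x → Σ ℕ λ y → InX n k g s x × InX n k g t y × InX n k g u ((x + y) % suc (n * k)))

OfShape : (n : ℕ) → ℤ → ℤ → ℤ → ℤ → Set
OfShape n j s t u =
  Σ ℤ λ i → (s modZ n ∷ t modZ n ∷ u modZ n ∷ [])
             ↭ (i modZ n ∷ i modZ n ∷ (i ℤ.+ j) modZ n ∷ [])

PrimitiveRoot : (p : ℕ) .{{_ : NonZero p}} → ℕ → Set
PrimitiveRoot p g = (¬ (p ∣ g)) × (∀ m → 1 ≤ m → m < p ∸ 1 → (g ^ m) % p ≢ 1)

-- Pick E ≡ j (mod n) coprime to n k: as gcd (j, n) = 1, the progression j + n t can be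
-- steered past the prime factors of n k one at a time.  Then h = g ^ E is a primitive root
-- lying in X_j, and since g ^ (n k) = 1 the coset Y_i of h is the coset X_(E i) of g:
-- h ^ (a n + i) = g ^ ((E a) n + E i), and a ↦ E a is invertible modulo k.  Hence (s, t, u) is
-- forbidden for h iff (E s, E t, E u) is forbidden for g, iff {E s, E t, E u} ≡ {i, i, i + j}
-- (mod n); multiplying by the inverse of E, which sends j to 1, this reads
-- {s, t, u} ≡ {i′, i′, i′ + 1}.  The identity g ^ (n k) = 1 comes from primitivity alone: by
-- pigeonhole two of g ^ 0, …, g ^ (n k) agree modulo p, and their exponents must differ by n k.

module Submission where

open import Data.Nat as ℕ using (ℕ; zero; suc; NonZero; _%_; _^_)
import Data.Nat.Properties as ℕ
open import Data.Nat.DivMod using (m%n%n≡m%n; %-distribˡ-*; m%n<n; m<n⇒m%n≡m; m≡m%n+[m/n]*n; _/_)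
open import Data.Nat.Divisibility using (_∣_; _∣?_; ∣-refl; ∣⇒≤; m%n≡0⇒n∣m; ∣n∣m%n⇒∣m; ∣-trans; ∣1⇒≡1; ∣m+n∣m⇒∣n; ∣n⇒∣m*n; ∣m⇒∣m*n)
open import Data.Nat.Coprimality as Coprime using (Coprime; coprime-divisor; coprime-Bézout; gcd≡1⇒coprime)
import Data.Nat.GCD as ℕ using (module Bézout)
open import Data.Nat.Primality using (Prime; euclidsLemma; ¬prime[1]; prime⇒irreducible)
open import Data.Nat.Primality.Factorisation using (factorise; PrimeFactorisation)
open import Data.Nat.ListAction using (product)
import Data.Nat.Tactic.RingSolver as ℕ using (solve-∀)
open import Data.Fin using (Fin; toℕ; fromℕ<)
import Data.Fin.Properties as Fin
open import Data.Integer as ℤ using (ℤ; +_; +[1+_]; -[1+_]; _+_; _*_; -_; _-_)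
import Data.Integer.Properties as ℤ
open import Data.Integer.DivMod using (_/ℕ_; a≡a%ℕn+[a/ℕn]*n; n%ℕd<d)
import Data.Integer.Divisibility.Signed as ℤ
open import Data.Integer.GCD using (gcd)
open import Data.Integer.Tactic.RingSolver using (solve-∀)
open import Data.List using (List; []; _∷_; map)
open import Data.List.Relation.Binary.Permutation.Propositional using (_↭_)
open import Data.List.Relation.Binary.Permutation.Propositional.Properties using (map⁺)
open import Data.List.Relation.Unary.All using (All; []; _∷_)
open import Data.Product using (Σ; ∃; _×_; _,_; proj₁; proj₂; map₂)
open import Data.Sum using (inj₁; inj₂; [_,_]′)
open import Level using (0ℓ)
open import Relation.Binary.Bundles using (Setoid)
import Relation.Binary.Reasoning.Setoid
open import Relation.Binary.PropositionalEquality
open import Function using (_∘_; flip)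
open import Function.Properties.Equivalence using (⇔-setoid)
open import Function.Bundles using (_⇔_; mk⇔; Equivalence)
open import Relation.Nullary using (¬_; yes; no; contradiction)
open import Defs

-- Congruences of integers

infix 4 _≡_mod_

record _≡_mod_ (a b : ℤ) (m : ℕ) : Set where
  constructor congruent
  field
    quotient : ℤ
    equation : a ≡ b + quotient * + m

module _ {m : ℕ} where

  ≡-mod-refl : ∀ {a} → a ≡ a mod m
  ≡-mod-refl {a} = congruent (+ 0) (sym (ℤ.+-identityʳ a))

  ≡⇒≡-mod : ∀ {a b} → a ≡ b → a ≡ b mod m
  ≡⇒≡-mod refl = ≡-mod-refl

  ≡-mod-sym : ∀ {a b} → a ≡ b mod m → b ≡ a mod m
  ≡-mod-sym {a} {b} (congruent q a≡) =
    congruent (- q) (trans (cancel b q (+ m)) (cong (_+ - q * + m) (sym a≡)))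
    where
    cancel : ∀ b q m → b ≡ (b + q * m) + - q * m
    cancel = solve-∀

  ≡-mod-trans : ∀ {a b c} → a ≡ b mod m → b ≡ c mod m → a ≡ c mod m
  ≡-mod-trans {c = c} (congruent q a≡) (congruent r b≡) =
    congruent (r + q) (trans a≡ (trans (cong (_+ q * + m) b≡) (regroup c r q (+ m))))
    where
    regroup : ∀ c r q m → (c + r * m) + q * m ≡ c + (r + q) * m
    regroup = solve-∀

  +-cong-mod : ∀ {a b c d} → a ≡ b mod m → c ≡ d mod m → a + c ≡ b + d mod m
  +-cong-mod {b = b} {d = d} (congruent q a≡) (congruent r c≡) =
    congruent (q + r) (trans (cong₂ _+_ a≡ c≡) (regroup b d q r (+ m)))
    where
    regroup : ∀ b d q r m → (b + q * m) + (d + r * m) ≡ (b + d) + (q + r) * m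
    regroup = solve-∀

  *-congˡ-mod : ∀ c {a b} → a ≡ b mod m → c * a ≡ c * b mod m
  *-congˡ-mod c {b = b} (congruent q a≡) =
    congruent (c * q) (trans (cong (c *_) a≡) (distrib c b q (+ m)))
    where
    distrib : ∀ c b q m → c * (b + q * m) ≡ c * b + (c * q) * m
    distrib = solve-∀

  *-congʳ-mod : ∀ c {a b} → a ≡ b mod m → a * c ≡ b * c mod m
  *-congʳ-mod c {a} {b} a≡b = subst₂ (_≡_mod m) (ℤ.*-comm c a) (ℤ.*-comm c b) (*-congˡ-mod c a≡b)

  ≡-mod⇒∣ : ∀ {a b} → a ≡ b mod m → + m ℤ.∣ a - b
  ≡-mod⇒∣ {a} {b} (congruent q a≡) = ℤ.divides q (trans (cong (_- b) a≡) (cancel b q (+ m)))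
    where
    cancel : ∀ b q m → (b + q * m) - b ≡ q * m
    cancel = solve-∀

  ∣⇒≡-mod : ∀ {a b} → + m ℤ.∣ a - b → a ≡ b mod m
  ∣⇒≡-mod {a} {b} (ℤ.divides q a-b≡) = congruent q (trans (restore a b) (cong (_+_ b) a-b≡))
    where
    restore : ∀ a b → a ≡ b + (a - b)
    restore = solve-∀

≡-mod-setoid : ℕ → Setoid 0ℓ 0ℓ
≡-mod-setoid m = record
  { Carrier       = ℤ
  ; _≈_           = _≡_mod m
  ; isEquivalence = record { refl = ≡-mod-refl ; sym = ≡-mod-sym ; trans = ≡-mod-trans }
  }

module ≡-mod-Reasoning (m : ℕ) = Relation.Binary.Reasoning.Setoid (≡-mod-setoid m)

module ⇔-Reasoning = Relation.Binary.Reasoning.Setoid (⇔-setoid 0ℓ)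

≡-mod-∣ : ∀ {m d a b} → a ≡ b mod m ℕ.* d → a ≡ b mod m
≡-mod-∣ {m} {d} {a} {b} (congruent q a≡) =
  congruent (q * + d) (trans a≡ (cong (_+_ b) (trans (cong (q *_) (ℤ.pos-* m d)) (regroup q (+ m) (+ d)))))
  where
  regroup : ∀ q m d → q * (m * d) ≡ (q * d) * m
  regroup = solve-∀

*-scaleʳ-mod : ∀ {m a b} c → a ≡ b mod m → a * + c ≡ b * + c mod c ℕ.* m
*-scaleʳ-mod {m} {b = b} c (congruent q a≡) =
  congruent q (trans (cong (_* + c) a≡) (trans (distrib b q (+ c) (+ m)) (cong (λ x → b * + c + q * x) (sym (ℤ.pos-* c m)))))
  where
  distrib : ∀ b q c m → (b + q * m) * c ≡ b * c + q * (c * m)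
  distrib = solve-∀

*-cancelˡ-mod-prime : ∀ {p a x y} → Prime p → ¬ p ∣ a → + a * x ≡ + a * y mod p → x ≡ y mod p
*-cancelˡ-mod-prime {p} {a} {x} {y} p-prime p∤a ax≡ay =
  [ flip contradiction p∤a , ∣⇒≡-mod ∘ ℤ.∣ᵤ⇒∣ ]′ (euclidsLemma a ℤ.∣ x - y ∣ p-prime p∣a∣x-y∣)
  where
  factor : ∀ a x y → a * x - a * y ≡ a * (x - y)
  factor = solve-∀
  p∣a∣x-y∣ : p ∣ a ℕ.* ℤ.∣ x - y ∣
  p∣a∣x-y∣ = subst (p ∣_) (ℤ.abs-* (+ a) (x - y))
    (ℤ.∣⇒∣ᵤ (subst (+ p ℤ.∣_) (factor (+ a) x y) (≡-mod⇒∣ ax≡ay)))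

-- Least non-negative residues

modZ-≡ : ∀ m .{{_ : NonZero m}} a → a ≡ + (a modZ m) mod m
modZ-≡ (suc m) a = congruent (a /ℕ suc m) (a≡a%ℕn+[a/ℕn]*n a (suc m))

modZ-< : ∀ m .{{_ : NonZero m}} a → a modZ m ℕ.< m
modZ-< (suc m) a = n%ℕd<d a (suc m)

modZ-+ : ∀ m .{{_ : NonZero m}} x → (+ x) modZ m ≡ x % m
modZ-+ (suc m) x = refl

no-wraparound : ∀ {m r s} x → r ℕ.< m → + r ≢ + s + +[1+ x ] * + m
no-wraparound {m} {r} {s} x r<m r≡ = ℕ.<⇒≱ r<m (begin
  m                   ≤⟨ ℕ.m≤m+n m (x ℕ.* m) ⟩
  suc x ℕ.* m         ≤⟨ ℕ.m≤n+m _ s ⟩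
  s ℕ.+ suc x ℕ.* m   ≡⟨ ℤ.+-injective (trans (ℤ.pos-+ s _) (trans (cong (_+_ (+ s)) (ℤ.pos-* (suc x) m)) (sym r≡))) ⟩
  r                   ∎)
  where open ℕ.≤-Reasoning

residue-unique : ∀ {m r s} → r ℕ.< m → s ℕ.< m → + r ≡ + s mod m → r ≡ s
residue-unique {s = s} _ _ (congruent (+ zero) r≡) = ℤ.+-injective (trans r≡ (ℤ.+-identityʳ (+ s)))
residue-unique r<m _ (congruent +[1+ x ] r≡) = contradiction r≡ (no-wraparound x r<m)
residue-unique _ s<m r≡s@(congruent -[1+ x ] _) =
  contradiction (_≡_mod_.equation (≡-mod-sym r≡s)) (no-wraparound x s<m)

modZ-cong : ∀ m .{{_ : NonZero m}} {a b} → a ≡ b mod m → a modZ m ≡ b modZ m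
modZ-cong m {a} {b} a≡b = residue-unique (modZ-< m a) (modZ-< m b) (begin
  + (a modZ m) ≈⟨ ≡-mod-sym (modZ-≡ m a) ⟩
  a            ≈⟨ a≡b ⟩
  b            ≈⟨ modZ-≡ m b ⟩
  + (b modZ m) ∎)
  where open ≡-mod-Reasoning m

%≡⇒≡-mod : ∀ {m} .{{_ : NonZero m}} {x y} → x % m ≡ y % m → + x ≡ + y mod m
%≡⇒≡-mod {suc m} {x} {y} x%≡y% = begin
  + x           ≈⟨ modZ-≡ (suc m) (+ x) ⟩
  + (x % suc m) ≡⟨ cong +_ x%≡y% ⟩
  + (y % suc m) ≈⟨ ≡-mod-sym (modZ-≡ (suc m) (+ y)) ⟩
  + y           ∎
  where open ≡-mod-Reasoning (suc m)

≡-mod⇒%≡ : ∀ {m} .{{_ : NonZero m}} {x y} → + x ≡ + y mod m → x % m ≡ y % m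
≡-mod⇒%≡ {suc m} = modZ-cong (suc m)

-- Coprime terms of arithmetic progressions

∣m+n∣n⇒∣m : ∀ {d x y} → d ∣ x ℕ.+ y → d ∣ y → d ∣ x
∣m+n∣n⇒∣m {d} {x} {y} d∣x+y = ∣m+n∣m⇒∣n (subst (d ∣_) (ℕ.+-comm x y) d∣x+y)

coprime-∣ʳ : ∀ {c m d} → Coprime c m → d ∣ m → Coprime c d
coprime-∣ʳ c⊥m d∣m (i∣c , i∣d) = c⊥m (i∣c , ∣-trans i∣d d∣m)

coprime-*ʳ : ∀ {c m n} → Coprime c m → Coprime c n → Coprime c (m ℕ.* n)
coprime-*ʳ {c} {m} {n} c⊥m c⊥n {i} (i∣c , i∣mn) =
  c⊥m (i∣c , coprime-divisor i⊥n (subst (i ∣_) (ℕ.*-comm m n) i∣mn))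
  where
  i⊥n : Coprime i n
  i⊥n (d∣i , d∣n) = c⊥n (∣-trans d∣i i∣c , d∣n)

coprime-+-* : ∀ {c m} b → Coprime c m → Coprime (c ℕ.+ b ℕ.* m) m
coprime-+-* b c⊥m (i∣c+bm , i∣m) = c⊥m (∣m+n∣n⇒∣m i∣c+bm (∣n⇒∣m*n b i∣m) , i∣m)

prime∤⇒coprime : ∀ {p x} → Prime p → ¬ p ∣ x → Coprime x p
prime∤⇒coprime p-prime p∤x (i∣x , i∣p) with prime⇒irreducible p-prime i∣p
... | inj₁ i≡1 = i≡1
... | inj₂ refl = contradiction i∣x p∤x

module _ {a b : ℕ} (a⊥b : Coprime a b) where

  coprime-progression-product : ∀ qs → All Prime qs → ∃ λ t → Coprime (a ℕ.+ b ℕ.* t) (product qs)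
  coprime-progression-product [] [] = 0 , λ (_ , i∣1) → ∣1⇒≡1 i∣1
  coprime-progression-product (q ∷ qs) (q-prime ∷ qs-prime)
    with t , c⊥M ← coprime-progression-product qs qs-prime
    with q ∣? product qs | q ∣? a ℕ.+ b ℕ.* t
  ... | yes q∣M | _       = t , coprime-*ʳ (coprime-∣ʳ c⊥M q∣M) c⊥M
  ... | no _    | no q∤c  = t , coprime-*ʳ (prime∤⇒coprime q-prime q∤c) c⊥M
  -- Here q ∣ c, so pass to t + M: c + b M stays coprime to M, and q ∤ b M as q ∤ b (a ⊥ b) and q ∤ M.
  ... | no q∤M  | yes q∣c = t ℕ.+ M , subst (λ x → Coprime x (q ℕ.* M)) (sym (shift a b t M))
        (coprime-*ʳ (prime∤⇒coprime q-prime q∤c+bM) (coprime-+-* b c⊥M))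
    where
    M : ℕ
    M = product qs
    shift : ∀ a b t M → a ℕ.+ b ℕ.* (t ℕ.+ M) ≡ (a ℕ.+ b ℕ.* t) ℕ.+ b ℕ.* M
    shift = ℕ.solve-∀
    q∤c+bM : ¬ q ∣ (a ℕ.+ b ℕ.* t) ℕ.+ b ℕ.* M
    q∤c+bM q∣c+bM with euclidsLemma b M q-prime (∣m+n∣m⇒∣n q∣c+bM q∣c)
    ... | inj₂ q∣M = q∤M q∣M
    ... | inj₁ q∣b = ¬prime[1] (subst Prime (a⊥b (q∣a , q∣b)) q-prime)
      where
      q∣a : q ∣ a
      q∣a = ∣m+n∣n⇒∣m q∣c (∣m⇒∣m*n t q∣b)

  coprime-progression : ∀ M .{{_ : NonZero M}} → ∃ λ t → Coprime (a ℕ.+ b ℕ.* t) M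
  coprime-progression M =
    map₂ (subst (Coprime _) (sym isFactorisation)) (coprime-progression-product factors factorsPrime)
    where open PrimeFactorisation (factorise M)

pos-+-* : ∀ a b c → + (a ℕ.+ b ℕ.* c) ≡ + a + + b * + c
pos-+-* a b c = trans (ℤ.pos-+ a (b ℕ.* c)) (cong (_+_ (+ a)) (ℤ.pos-* b c))

coprime-modZ : ∀ {n} .{{_ : NonZero n}} j → gcd j (+ n) ≡ + 1 → Coprime (j modZ n) n
coprime-modZ {n} j gcd≡1 {i} (i∣r , i∣n) = gcd≡1⇒coprime (ℤ.+-injective gcd≡1) (i∣∣j∣ , i∣n)
  where
  open _≡_mod_ (modZ-≡ n j)
  i∣∣j∣ : i ∣ ℤ.∣ j ∣
  i∣∣j∣ = ℤ.∣⇒∣ᵤ (subst (+ i ℤ.∣_) (sym equation)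
    (ℤ.∣m∣n⇒∣m+n (ℤ.∣ᵤ⇒∣ {+ i} {+ (j modZ n)} i∣r) (ℤ.∣n⇒∣m*n quotient (ℤ.∣ᵤ⇒∣ {+ i} {+ n} i∣n))))

unit-in-residue-class : ∀ {n} .{{_ : NonZero n}} {j} → gcd j (+ n) ≡ + 1 →
                        ∀ N .{{_ : NonZero N}} → ∃ λ E → + E ≡ j mod n × Coprime E N
unit-in-residue-class {n} {j} gcd≡1 N with t , E⊥N ← coprime-progression (coprime-modZ j gcd≡1) N =
  j modZ n ℕ.+ n ℕ.* t , E≡j , E⊥N
  where
  E≡j : + (j modZ n ℕ.+ n ℕ.* t) ≡ j mod n
  E≡j = ≡-mod-trans (congruent (+ t) (trans (pos-+-* (j modZ n) n t) (cong (_+_ (+ (j modZ n))) (ℤ.*-comm (+ n) (+ t)))))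
                    (≡-mod-sym (modZ-≡ n j))

inverse-mod : ∀ {E N} → Coprime E N → ∃ λ F → + E * F ≡ + 1 mod N
inverse-mod {E} {N} E⊥N with coprime-Bézout E⊥N
... | ℕ.Bézout.+- x y 1+yN≡xE = + x , congruent (+ y) (begin
  + E * + x        ≡⟨ ℤ.*-comm (+ E) (+ x) ⟩
  + x * + E        ≡⟨ ℤ.pos-* x E ⟨
  + (x ℕ.* E)      ≡⟨ cong +_ 1+yN≡xE ⟨
  + (1 ℕ.+ y ℕ.* N) ≡⟨ pos-+-* 1 y N ⟩
  + 1 + + y * + N  ∎)
  where open ≡-Reasoning
... | ℕ.Bézout.-+ x y 1+xE≡yN = - + x , congruent (- + y) (begin
  + E * - + x                ≡⟨ expand (+ E) (+ x) ⟩
  + 1 - (+ 1 + + x * + E)    ≡⟨ cong (λ z → + 1 - z) (trans (sym (pos-+-* 1 x E)) (trans (cong +_ 1+xE≡yN) (ℤ.pos-* y N))) ⟩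
  + 1 - + y * + N            ≡⟨ regroup (+ y) (+ N) ⟩
  + 1 + - + y * + N          ∎)
  where
  open ≡-Reasoning
  expand : ∀ e x → e * - x ≡ + 1 - (+ 1 + x * e)
  expand = solve-∀
  regroup : ∀ y n → + 1 - y * n ≡ + 1 + - y * n
  regroup = solve-∀

-- Powers modulo a prime

%-distribˡ-^ : ∀ m n d .{{_ : NonZero d}} → (m ^ n) % d ≡ ((m % d) ^ n) % d
%-distribˡ-^ m zero d = refl
%-distribˡ-^ m (suc n) d = begin
  (m ℕ.* m ^ n) % d                           ≡⟨ %-distribˡ-* m (m ^ n) d ⟩
  ((m % d) ℕ.* ((m ^ n) % d)) % d             ≡⟨ cong (λ x → ((m % d) ℕ.* x) % d) (%-distribˡ-^ m n d) ⟩
  ((m % d) ℕ.* (((m % d) ^ n) % d)) % d       ≡⟨ cong (λ x → (x ℕ.* (((m % d) ^ n) % d)) % d) (m%n%n≡m%n m d) ⟨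
  ((m % d % d) ℕ.* (((m % d) ^ n) % d)) % d   ≡⟨ %-distribˡ-* (m % d) ((m % d) ^ n) d ⟨
  ((m % d) ℕ.* (m % d) ^ n) % d               ∎
  where open ≡-Reasoning

prime∤⇒∤^ : ∀ {p g} → Prime p → ¬ p ∣ g → ∀ e → ¬ p ∣ g ^ e
prime∤⇒∤^ p-prime p∤g zero p∣1 = ¬prime[1] (subst Prime (∣1⇒≡1 p∣1) p-prime)
prime∤⇒∤^ {g = g} p-prime p∤g (suc e) p∣g^1+e with euclidsLemma g (g ^ e) p-prime p∣g^1+e
... | inj₁ p∣g   = p∤g p∣g
... | inj₂ p∣g^e = prime∤⇒∤^ p-prime p∤g e p∣g^e

module _ {N : ℕ} .{{_ : NonZero N}} where

  private
    P : ℕ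
    P = suc N

  1%[1+N]≡1 : 1 % P ≡ 1
  1%[1+N]≡1 = m<n⇒m%n≡m (ℕ.s≤s (ℕ.>-nonZero⁻¹ N))

  %≡1⇒^%≡1 : ∀ {x} q → x % P ≡ 1 → (x ^ q) % P ≡ 1
  %≡1⇒^%≡1 {x} q x%P≡1 = begin
    (x ^ q) % P        ≡⟨ %-distribˡ-^ x q P ⟩
    ((x % P) ^ q) % P  ≡⟨ cong (λ y → (y ^ q) % P) x%P≡1 ⟩
    (1 ^ q) % P        ≡⟨ cong (_% P) (ℕ.^-zeroˡ q) ⟩
    1 % P              ≡⟨ 1%[1+N]≡1 ⟩
    1                  ∎
    where open ≡-Reasoning

module _ {N : ℕ} .{{_ : NonZero N}} {g : ℕ} where

  private
    P : ℕ
    P = suc N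

  ^-periodic : g ^ N % P ≡ 1 → ∀ e → g ^ e % P ≡ g ^ (e % N) % P
  ^-periodic g^N≡1 e = begin
    g ^ e % P                                        ≡⟨ cong (λ x → g ^ x % P) (m≡m%n+[m/n]*n e N) ⟩
    g ^ (r ℕ.+ q ℕ.* N) % P                          ≡⟨ cong (_% P) (ℕ.^-distribˡ-+-* g r (q ℕ.* N)) ⟩
    (g ^ r ℕ.* g ^ (q ℕ.* N)) % P                    ≡⟨ %-distribˡ-* (g ^ r) (g ^ (q ℕ.* N)) P ⟩
    (g ^ r % P ℕ.* (g ^ (q ℕ.* N) % P)) % P          ≡⟨ cong (λ x → (g ^ r % P ℕ.* x) % P) g^qN≡1 ⟩
    (g ^ r % P ℕ.* 1) % P                            ≡⟨ cong (_% P) (ℕ.*-identityʳ (g ^ r % P)) ⟩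
    g ^ r % P % P                                    ≡⟨ m%n%n≡m%n (g ^ r) P ⟩
    g ^ r % P                                        ∎
    where
    open ≡-Reasoning
    r q : ℕ
    r = e % N
    q = e / N
    g^qN≡1 : g ^ (q ℕ.* N) % P ≡ 1
    g^qN≡1 = trans (cong (λ x → g ^ x % P) (ℕ.*-comm q N))
                   (trans (cong (_% P) (sym (ℕ.^-*-assoc g N q))) (%≡1⇒^%≡1 q g^N≡1))

  module _ (P-prime : Prime P) (P∤g : ¬ P ∣ g) where

    ^-cancel : ∀ i d → g ^ i % P ≡ g ^ (i ℕ.+ d) % P → g ^ d % P ≡ 1
    ^-cancel i d g^i≡g^i+d = trans (sym (≡-mod⇒%≡ 1≡g^d)) 1%[1+N]≡1
      where
      g^i*1≡g^i*g^d : + (g ^ i) * + 1 ≡ + (g ^ i) * + (g ^ d) mod P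
      g^i*1≡g^i*g^d = begin
        + (g ^ i) * + 1          ≡⟨ ℤ.*-identityʳ (+ (g ^ i)) ⟩
        + (g ^ i)                ≈⟨ %≡⇒≡-mod g^i≡g^i+d ⟩
        + (g ^ (i ℕ.+ d))        ≡⟨ cong +_ (ℕ.^-distribˡ-+-* g i d) ⟩
        + (g ^ i ℕ.* g ^ d)      ≡⟨ ℤ.pos-* (g ^ i) (g ^ d) ⟩
        + (g ^ i) * + (g ^ d)    ∎
        where open ≡-mod-Reasoning P
      1≡g^d : + 1 ≡ + (g ^ d) mod P
      1≡g^d = *-cancelˡ-mod-prime P-prime (prime∤⇒∤^ P-prime P∤g i) g^i*1≡g^i*g^d

    -- The N + 1 residues g ^ e % P with e ≤ N lie in 1 … N, so two of them coincide.
    private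
      nonzero : ∀ e → g ^ e % P ≢ 0
      nonzero e g^e≡0 = prime∤⇒∤^ P-prime P∤g e (m%n≡0⇒n∣m (g ^ e) P g^e≡0)

      index : Fin (suc N) → Fin N
      index e = fromℕ< (ℕ.pred-mono-< {{ℕ.≢-nonZero (nonzero (toℕ e))}} (m%n<n (g ^ toℕ e) P))

      index-value : ∀ e → suc (toℕ (index e)) ≡ g ^ toℕ e % P
      index-value e = trans (cong suc (Fin.toℕ-fromℕ< _)) (ℕ.suc-pred _ {{ℕ.≢-nonZero (nonzero (toℕ e))}})

    power≡1-exists : ∃ λ d → 1 ℕ.≤ d × d ℕ.≤ N × g ^ d % P ≡ 1
    power≡1-exists with i , j , i<j , same-index ← Fin.pigeonhole (ℕ.n<1+n N) index =
      toℕ j ℕ.∸ toℕ i , ℕ.m<n⇒0<n∸m i<j , ℕ.≤-trans (ℕ.m∸n≤m (toℕ j) (toℕ i)) (ℕ.s≤s⁻¹ (Fin.toℕ<n j)) ,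
      ^-cancel (toℕ i) (toℕ j ℕ.∸ toℕ i) (subst (λ e → g ^ toℕ i % P ≡ g ^ e % P) (sym (ℕ.m+[n∸m]≡n (ℕ.<⇒≤ i<j)))
        (trans (sym (index-value i)) (trans (cong (suc ∘ toℕ) same-index) (index-value j))))

module _ {N : ℕ} .{{_ : NonZero N}} {g : ℕ} (P-prime : Prime (suc N)) (g-prim : PrimitiveRoot (suc N) g) where

  private
    P : ℕ
    P = suc N

  primitiveRoot⇒fermat : g ^ N % P ≡ 1
  primitiveRoot⇒fermat = only-period-N (power≡1-exists P-prime (proj₁ g-prim))
    where
    only-period-N : (∃ λ d → 1 ℕ.≤ d × d ℕ.≤ N × g ^ d % P ≡ 1) → g ^ N % P ≡ 1
    only-period-N (d , 1≤d , d≤N , g^d≡1) =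
      [ (λ d<N → contradiction g^d≡1 (proj₂ g-prim d 1≤d d<N)) , (λ d≡N → subst (λ e → g ^ e % P ≡ 1) d≡N g^d≡1) ]′
      (ℕ.m≤n⇒m<n∨m≡n d≤N)

  primitiveRoot-pow : ∀ {E} → Coprime E N → PrimitiveRoot P (g ^ E % P)
  primitiveRoot-pow {E} E⊥N = P∤g^E%P , order
    where
    P∤g^E%P : ¬ P ∣ g ^ E % P
    P∤g^E%P P∣ = prime∤⇒∤^ P-prime (proj₁ g-prim) E (∣n∣m%n⇒∣m ∣-refl P∣)
    order : ∀ m → 1 ℕ.≤ m → m ℕ.< N → (g ^ E % P) ^ m % P ≢ 1
    order m 1≤m m<N h^m≡1 with (E ℕ.* m) % N ℕ.≟ 0
    ... | yes Em%N≡0 = ℕ.<⇒≱ m<N (∣⇒≤ {{ℕ.>-nonZero 1≤m}} (coprime-divisor (Coprime.sym E⊥N) (m%n≡0⇒n∣m (E ℕ.* m) N Em%N≡0)))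
    ... | no Em%N≢0  = proj₂ g-prim ((E ℕ.* m) % N) (ℕ.n≢0⇒n>0 Em%N≢0) (m%n<n (E ℕ.* m) N) (begin
      g ^ ((E ℕ.* m) % N) % P ≡⟨ ^-periodic primitiveRoot⇒fermat (E ℕ.* m) ⟨
      g ^ (E ℕ.* m) % P       ≡⟨ cong (_% P) (ℕ.^-*-assoc g E m) ⟨
      (g ^ E) ^ m % P         ≡⟨ %-distribˡ-^ (g ^ E) m P ⟩
      (g ^ E % P) ^ m % P     ≡⟨ h^m≡1 ⟩
      1                       ∎)
      where open ≡-Reasoning

-- The cosets X_i

module _ {n k : ℕ} .{{_ : NonZero n}} .{{_ : NonZero k}} where

  private
    N P : ℕ
    N = n ℕ.* k
    P = suc N
    instance
      N≢0 : NonZero N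
      N≢0 = ℕ.m*n≢0 n k

  powZ-cong : ∀ {g e e′} → e ≡ e′ mod N → powZ n k g e ≡ powZ n k g e′
  powZ-cong {g} e≡e′ = cong (λ r → g ^ r % P) (modZ-cong N e≡e′)

  -- Only c modulo k matters, as c n is read modulo n k.
  InX-intro : ∀ {g i} x c → x % P ≡ powZ n k g (c * + n + i) → InX n k g i x
  InX-intro {i = i} x c x≡ = c modZ k , modZ-< k c , trans x≡ (powZ-cong (+-cong-mod cn≡an ≡-mod-refl))
    where
    cn≡an : c * + n ≡ + ((c modZ k) ℕ.* n) mod N
    cn≡an = ≡-mod-trans (*-scaleʳ-mod n (modZ-≡ k c)) (≡⇒≡-mod (sym (ℤ.pos-* (c modZ k) n)))

  module _ {g : ℕ} (g^N≡1 : g ^ N % P ≡ 1) where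

    powZ-+ : ∀ e → powZ n k g (+ e) ≡ g ^ e % P
    powZ-+ e = trans (cong (λ r → g ^ r % P) (modZ-+ N e)) (sym (^-periodic g^N≡1 e))

    powZ-pow : ∀ E e → powZ n k (g ^ E % P) e ≡ powZ n k g (+ E * e)
    powZ-pow E e = begin
      (g ^ E % P) ^ r % P      ≡⟨ %-distribˡ-^ (g ^ E) r P ⟨
      (g ^ E) ^ r % P          ≡⟨ cong (_% P) (ℕ.^-*-assoc g E r) ⟩
      g ^ (E ℕ.* r) % P        ≡⟨ powZ-+ (E ℕ.* r) ⟨
      powZ n k g (+ (E ℕ.* r)) ≡⟨ powZ-cong Er≡Ee ⟩
      powZ n k g (+ E * e)     ∎
      where
      open ≡-Reasoning
      r : ℕ
      r = e modZ N
      Er≡Ee : + (E ℕ.* r) ≡ + E * e mod N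
      Er≡Ee = ≡-mod-trans (≡⇒≡-mod (ℤ.pos-* E r)) (*-congˡ-mod (+ E) (≡-mod-sym (modZ-≡ N e)))

    InX-pow-residue : ∀ {E j} → + E ≡ j mod n → InX n k g j (g ^ E % P)
    InX-pow-residue {E} {j} (congruent q E≡) = InX-intro (g ^ E % P) q (begin
      g ^ E % P % P          ≡⟨ m%n%n≡m%n (g ^ E) P ⟩
      g ^ E % P              ≡⟨ powZ-+ E ⟨
      powZ n k g (+ E)       ≡⟨ cong (powZ n k g) (trans E≡ (ℤ.+-comm j (q * + n))) ⟩
      powZ n k g (q * + n + j) ∎)
      where open ≡-Reasoning

    InX-pow : ∀ E {F} → + E * F ≡ + 1 mod N → ∀ i x → InX n k (g ^ E % P) i x ⇔ InX n k g (+ E * i) x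
    InX-pow E {F} EF≡1 i x = mk⇔ to from
      where
      to : InX n k (g ^ E % P) i x → InX n k g (+ E * i) x
      to (a , _ , x≡) = InX-intro x (+ E * + a) (begin
        x % P                                 ≡⟨ x≡ ⟩
        powZ n k (g ^ E % P) (+ (a ℕ.* n) + i) ≡⟨ powZ-pow E _ ⟩
        powZ n k g (+ E * (+ (a ℕ.* n) + i))   ≡⟨ cong (λ y → powZ n k g (+ E * (y + i))) (ℤ.pos-* a n) ⟩
        powZ n k g (+ E * (+ a * + n + i))     ≡⟨ cong (powZ n k g) (distrib (+ E) (+ a) (+ n) i) ⟩
        powZ n k g ((+ E * + a) * + n + + E * i) ∎)
        where
        open ≡-Reasoning
        distrib : ∀ e a n i → e * (a * n + i) ≡ (e * a) * n + e * i
        distrib = solve-∀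
      from : InX n k g (+ E * i) x → InX n k (g ^ E % P) i x
      from (b , _ , x≡) = InX-intro x (F * + b) (trans x≡ (sym (trans (powZ-pow E _) (powZ-cong exponent≡))))
        where
        distrib : ∀ e f b n i → e * ((f * b) * n + i) ≡ (e * f) * (b * n) + e * i
        distrib = solve-∀
        exponent≡ : + E * ((F * + b) * + n + i) ≡ + (b ℕ.* n) + + E * i mod N
        exponent≡ = begin
          + E * ((F * + b) * + n + i)        ≡⟨ distrib (+ E) F (+ b) (+ n) i ⟩
          (+ E * F) * (+ b * + n) + + E * i  ≈⟨ +-cong-mod (*-congʳ-mod (+ b * + n) EF≡1) ≡-mod-refl ⟩
          + 1 * (+ b * + n) + + E * i        ≡⟨ cong (_+ + E * i) (trans (ℤ.*-identityˡ (+ b * + n)) (sym (ℤ.pos-* b n))) ⟩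
          + (b ℕ.* n) + + E * i              ∎
          where open ≡-mod-Reasoning N

  Forbidden-transport : ∀ {g h} (f : ℤ → ℤ) → (∀ i x → InX n k h i x ⇔ InX n k g (f i) x) →
                        ∀ s t u → Forbidden n k h s t u ⇔ Forbidden n k g (f s) (f t) (f u)
  Forbidden-transport {g} {h} f X⇔ s t u = mk⇔
    (λ h-forbidden (x , y , x∈ , y∈ , x+y∈) →
       h-forbidden (x , y , from s x x∈ , from t y y∈ , from u ((x ℕ.+ y) % P) x+y∈))
    (λ g-forbidden (x , y , x∈ , y∈ , x+y∈) →
       g-forbidden (x , y , to s x x∈ , to t y y∈ , to u ((x ℕ.+ y) % P) x+y∈))
    where
    to : ∀ i x → InX n k h i x → InX n k g (f i) x
    to i x = Equivalence.to (X⇔ i x)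
    from : ∀ i x → InX n k g (f i) x → InX n k h i x
    from i x = Equivalence.from (X⇔ i x)

-- Residue patterns

module _ {n : ℕ} .{{_ : NonZero n}} where

  residues : ℤ → ℤ → ℤ → List ℕ
  residues s t u = s modZ n ∷ t modZ n ∷ u modZ n ∷ []

  residues-cong : ∀ {s s′ t t′ u u′} → s ≡ s′ mod n → t ≡ t′ mod n → u ≡ u′ mod n →
                  residues s t u ≡ residues s′ t′ u′
  residues-cong s≡ t≡ u≡ =
    cong₂ _∷_ (modZ-cong n s≡) (cong₂ _∷_ (modZ-cong n t≡) (cong₂ _∷_ (modZ-cong n u≡) refl))

  map-residues : ∀ c s t u → map (λ r → (c * + r) modZ n) (residues s t u) ≡ residues (c * s) (c * t) (c * u)
  map-residues c s t u = residues-cong (scale s) (scale t) (scale u)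
    where
    scale : ∀ x → c * + (x modZ n) ≡ c * x mod n
    scale x = *-congˡ-mod c (≡-mod-sym (modZ-≡ n x))

  OfShape-scale : ∀ c {j s t u} → OfShape n j s t u → OfShape n (c * j) (c * s) (c * t) (c * u)
  OfShape-scale c {j} {s} {t} {u} (i , perm) = c * i , subst₂ _↭_ (map-residues c s t u)
    (trans (map-residues c i i (i + j)) (residues-cong (≡-mod-refl {a = c * i}) ≡-mod-refl (≡⇒≡-mod (ℤ.*-distribˡ-+ c i j))))
    (map⁺ (λ r → (c * + r) modZ n) perm)

  OfShape-cong : ∀ {j j′ s s′ t t′ u u′} → j ≡ j′ mod n → s ≡ s′ mod n → t ≡ t′ mod n → u ≡ u′ mod n →
                 OfShape n j s t u → OfShape n j′ s′ t′ u′
  OfShape-cong j≡ s≡ t≡ u≡ (i , perm) =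
    i , subst₂ _↭_ (residues-cong s≡ t≡ u≡) (residues-cong ≡-mod-refl ≡-mod-refl (+-cong-mod (≡-mod-refl {a = i}) j≡)) perm

  OfShape-rescale : ∀ {c d j} → c * d ≡ + 1 mod n → c ≡ j mod n →
                    ∀ s t u → OfShape n (+ 1) s t u ⇔ OfShape n j (c * s) (c * t) (c * u)
  OfShape-rescale {c} {d} {j} cd≡1 c≡j s t u = mk⇔
    (λ shape → OfShape-cong (≡-mod-trans (≡⇒≡-mod (ℤ.*-identityʳ c)) c≡j) ≡-mod-refl ≡-mod-refl ≡-mod-refl (OfShape-scale c shape))
    (λ shape → OfShape-cong dj≡1 (undo s) (undo t) (undo u) (OfShape-scale d shape))
    where
    open ≡-mod-Reasoning n
    dj≡1 : d * j ≡ + 1 mod n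
    dj≡1 = begin
      d * j ≈⟨ *-congˡ-mod d (≡-mod-sym c≡j) ⟩
      d * c ≡⟨ ℤ.*-comm d c ⟩
      c * d ≈⟨ cd≡1 ⟩
      + 1   ∎
    undo : ∀ x → d * (c * x) ≡ x mod n
    undo x = begin
      d * (c * x) ≡⟨ ℤ.*-assoc d c x ⟨
      (d * c) * x ≡⟨ cong (_* x) (ℤ.*-comm d c) ⟩
      (c * d) * x ≈⟨ *-congʳ-mod x cd≡1 ⟩
      + 1 * x     ≡⟨ ℤ.*-identityˡ x ⟩
      x           ∎

lemma6 : (n k : ℕ) → .{{_ : NonZero n}} → .{{_ : NonZero k}} → 2 ∣ k → Prime (suc (n ℕ.* k))
    → (g : ℕ) → PrimitiveRoot (suc (n ℕ.* k)) g
    → (j : ℤ) → gcd j (+ n) ≡ + 1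
    → (∀ s t u → Forbidden n k g s t u ⇔ OfShape n j s t u)
    → Σ ℕ λ h → InX n k g j h × PrimitiveRoot (suc (n ℕ.* k)) h
        × (∀ s t u → Forbidden n k h s t u ⇔ OfShape n (+ 1) s t u)
lemma6 n k _ P-prime g g-prim j gcd≡1 g-forbidden⇔shape
  with E , E≡j , E⊥N ← unit-in-residue-class {n = n} gcd≡1 (n ℕ.* k) {{ℕ.m*n≢0 n k}}
  with F , EF≡1 ← inverse-mod E⊥N =
  h , InX-pow-residue g^N≡1 E≡j , primitiveRoot-pow P-prime g-prim E⊥N , h-forbidden⇔shape
  where
  P h : ℕ
  P = suc (n ℕ.* k)
  h = g ^ E % P
  instance
    nk≢0 : NonZero (n ℕ.* k)
    nk≢0 = ℕ.m*n≢0 n k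
  g^N≡1 : g ^ (n ℕ.* k) % P ≡ 1
  g^N≡1 = primitiveRoot⇒fermat P-prime g-prim
  h-forbidden⇔shape : ∀ s t u → Forbidden n k h s t u ⇔ OfShape n (+ 1) s t u
  h-forbidden⇔shape s t u = begin
    Forbidden n k h s t u                         ≈⟨ Forbidden-transport (+ E *_) (InX-pow g^N≡1 E EF≡1) s t u ⟩
    Forbidden n k g (+ E * s) (+ E * t) (+ E * u) ≈⟨ g-forbidden⇔shape (+ E * s) (+ E * t) (+ E * u) ⟩
    OfShape n j (+ E * s) (+ E * t) (+ E * u)     ≈⟨ OfShape-rescale (≡-mod-∣ EF≡1) E≡j s t u ⟨
    OfShape n (+ 1) s t u                         ∎
    where open ⇔-Reasoning
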